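{- For every positive integer $d$ and every configuration $H$ in $Q_d$, $\pi(H,d)\geq \frac{d!}{d^d}$.
   Context: $Q_n$ is the $n$-dimensional hypercube graph: vertices are binary $n$-tuples, adjacent iff they differ in exactly one coordinate. A sub-$d$-cube of $Q_n$ is obtained by fixing $n-d$ coordinates and letting the other $d$ vary; there are $\binom{n}{d}2^{n-d}$ of them, each identified with $Q_d$ via its varying coordinates. A configuration in $Q_d$ is a subset of $V(Q_d)$. $K$ is an exact copy of $H$ if some automorphism of $Q_d$ maps $H$ onto $K$. For a configuration $H$ in $Q_d$ and $S\subseteq V(Q_n)$, let $g(H,d,n,S)$ be the fraction of sub-$d$-cubes $R$ of $Q_n$ for which $S\cap R$ is an exact copy of $H$, $\mathrm{ex}(H,d,n)=\max_{S\subseteq V(Q_n)} g(H,d,n,S)$ (nonincreasing in $n$), and $\pi(H,d)=\lim_{n\to\infty}\mathrm{ex}(H,d,n)$. -}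

module Defs where

open import Data.Bool using (Bool; true; false; _xor_; if_then_else_)
open import Data.Maybe using (Maybe; just; nothing)
open import Data.Nat using (ℕ; zero; suc; _+_; _*_; _∸_; _^_; _≤_; _!)
open import Data.Nat.Combinatorics using (_C_)
open import Data.Vec using (Vec; []; _∷_)
open import Data.List using (List; length)
open import Data.List.Relation.Unary.All using (All)
open import Data.List.Relation.Unary.Unique.Propositional using (Unique)
open import Data.Product using (Σ; _×_)
open import Function.Bundles using (_↔_; Inverse)
open import Relation.Binary.PropositionalEquality using (_≡_; subst)

Vertex : ℕ → Set
Vertex n = Vec Bool n

dist : ∀ {n} → Vertex n → Vertex n → ℕ
dist [] [] = 0
dist (a ∷ xs) (b ∷ ys) = (if a xor b then 1 else 0) + dist xs ys

Adjacent : ∀ {n} → Vertex n → Vertex n → Set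
Adjacent x y = dist x y ≡ 1

-- A configuration in Q_d: a subset of V(Q_d), as a characteristic function.
Config : ℕ → Set
Config d = Vertex d → Bool

IsAutomorphism : ∀ {d} → Vertex d ↔ Vertex d → Set
IsAutomorphism {d} σ =
  ∀ (x y : Vertex d) → (Adjacent x y → Adjacent (Inverse.to σ x) (Inverse.to σ y))
                     × (Adjacent (Inverse.to σ x) (Inverse.to σ y) → Adjacent x y)

ExactCopy : ∀ {d} → Config d → Config d → Set
ExactCopy {d} H K =
  Σ (Vertex d ↔ Vertex d) λ σ → IsAutomorphism σ × (∀ x → K (Inverse.to σ x) ≡ H x)

-- A subcube pattern of Q_n: each coordinate is either fixed (just b) or varying (nothing).
Pattern : ℕ → Set
Pattern n = Vec (Maybe Bool) n

free : ∀ {n} → Pattern n → ℕ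
free [] = 0
free (nothing ∷ p) = suc (free p)
free (just _ ∷ p) = free p

fill : ∀ {n} → (p : Pattern n) → Vertex (free p) → Vertex n
fill [] [] = []
fill (nothing ∷ p) (b ∷ v) = b ∷ fill p v
fill (just c ∷ p) v = c ∷ fill p v

trace : ∀ {n} → Config n → (p : Pattern n) → Config (free p)
trace S p x = S (fill p x)

Good : ∀ {n} (d : ℕ) → Config d → Config n → Pattern n → Set
Good d H S p = Σ (free p ≡ d) λ eq → ExactCopy H (subst Config eq (trace S p))

-- g(H,d,n,S) ≥ a / b : at least (a/b) * binom(n,d) 2^(n-d) of the sub-d-cubes R
-- have S ∩ R an exact copy of H (witnessed by a duplicate-free list of them).
gAtLeast : ∀ {n} (d : ℕ) → Config d → Config n → ℕ → ℕ → Set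
gAtLeast {n} d H S a b =
  Σ (List (Pattern n)) λ L → Unique L × All (Good d H S) L
    × (a * ((n C d) * 2 ^ (n ∸ d)) ≤ b * length L)

-- ex(H,d,n) ≥ a / b  (ex is a maximum over the finitely many S ⊆ V(Q_n))
exAtLeast : (d : ℕ) → Config d → ℕ → ℕ → ℕ → Set
exAtLeast d H n a b = Σ (Config n) λ S → gAtLeast d H S a b

-- Split the n coordinates of Q_n into d consecutive blocks of sizes s₁, …, s_d and let
-- S be the set of vertices whose vector of block parities lies in H.  On a sub-d-cube
-- with exactly one varying coordinate in each block the parity map is a translation
-- of Q_d, an automorphism, so S meets it in an exact copy of H.  There are
-- s₁ ⋯ s_d · 2^(n-d) such sub-cubes, a fraction s₁ ⋯ s_d / C(n,d) of all of them.  With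
-- balanced blocks, the i-th factor n - i of d! C(n,d) = n (n-1) ⋯ (n-d+1) is at most
-- d · s_i, so this fraction is at least d! / d^d.
module Submission where

open import Defs
open import Algebra.Properties.CommutativeSemigroup using (x∙yz≈y∙xz)
open import Data.Bool using (Bool; true; false; _xor_; if_then_else_)
open import Data.Bool.Properties using (xor-assoc; xor-comm; xor-identityʳ; xor-same)
open import Data.List using (List; length; _++_) renaming ([] to []ˡ; _∷_ to _∷ˡ_; map to mapˡ)
open import Data.List.Properties using (length-map; length-++)
open import Data.List.Membership.Propositional using (_∈_)
open import Data.List.Membership.Propositional.Properties using (∈-map⁻; ∈-++⁻)
open import Data.List.Relation.Binary.Disjoint.Propositional using (Disjoint)
open import Data.List.Relation.Unary.All as All using (All)
import Data.List.Relation.Unary.All.Properties as All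
import Data.List.Relation.Unary.AllPairs as AllPairs
open import Data.List.Relation.Unary.Unique.Propositional using (Unique)
import Data.List.Relation.Unary.Unique.Propositional.Properties as Unique
open import Data.Maybe using (Maybe; just; nothing)
open import Data.Nat using (ℕ; zero; suc; _+_; _*_; _∸_; _^_; _≤_; _≤ᵇ_; _!; z≤n; s≤s; pred)
open import Data.Nat.Combinatorics using (_C_; _P_; nCk≡nPk/k!)
open import Data.Nat.Combinatorics.Base using (_P′_)
open import Data.Nat.DivMod using (_/_; _%_; m≡m%n+[m/n]*n; m%n<n; m/n*n≤m; m≥n⇒m/n>0)
open import Data.Nat.Properties
open import Data.Nat.Tactic.RingSolver using (solve-∀)
open import Data.Product using (Σ; _×_; _,_)
open import Data.Sum using (inj₁; inj₂)
open import Data.Unit using (⊤; tt)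
open import Data.Vec using (Vec; []; _∷_; zipWith; map; sum; foldr; head)
open import Data.Vec.Properties using (∷-injectiveʳ)
open import Function using (_∘_)
open import Function.Bundles using (_↔_; mk↔ₛ′)
open import Relation.Binary.PropositionalEquality

private variable
  j n : ℕ

_⊕_ : Vertex n → Vertex n → Vertex n
_⊕_ = zipWith _xor_

xor-cancelʳ : ∀ a b → (a xor b) xor b ≡ a
xor-cancelʳ a b = trans (xor-assoc a b b) (trans (cong (a xor_) (xor-same b)) (xor-identityʳ a))

xor-swap : ∀ a b e → (a xor b) xor e ≡ b xor (a xor e)
xor-swap a b e = trans (cong (_xor e) (xor-comm a b)) (xor-assoc b a e)

xor-translation-invariant : ∀ a b c → (a xor c) xor (b xor c) ≡ a xor b
xor-translation-invariant false false false = refl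
xor-translation-invariant false false true  = refl
xor-translation-invariant false true  false = refl
xor-translation-invariant false true  true  = refl
xor-translation-invariant true  false false = refl
xor-translation-invariant true  false true  = refl
xor-translation-invariant true  true  false = refl
xor-translation-invariant true  true  true  = refl

⊕-involutive : (x c : Vertex n) → (x ⊕ c) ⊕ c ≡ x
⊕-involutive []      []      = refl
⊕-involutive (a ∷ x) (b ∷ c) = cong₂ _∷_ (xor-cancelʳ a b) (⊕-involutive x c)

dist-⊕ : (x y c : Vertex n) → dist (x ⊕ c) (y ⊕ c) ≡ dist x y
dist-⊕ []      []      []      = refl
dist-⊕ (a ∷ x) (b ∷ y) (c ∷ z) =
  cong₂ (λ u w → (if u then 1 else 0) + w) (xor-translation-invariant a b c) (dist-⊕ x y z)

translation : Vertex n → Vertex n ↔ Vertex n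
translation c = mk↔ₛ′ (_⊕ c) (_⊕ c) (λ x → ⊕-involutive x c) (λ x → ⊕-involutive x c)

translation-isAutomorphism : (c : Vertex n) → IsAutomorphism (translation c)
translation-isAutomorphism c x y = trans (dist-⊕ x y c) , trans (sym (dist-⊕ x y c))

exactCopy-translate : (H K : Config n) (c : Vertex n) → (∀ v → K v ≡ H (v ⊕ c)) → ExactCopy H K
exactCopy-translate H K c K≡H∘⊕c =
  translation c , translation-isAutomorphism c ,
  λ x → trans (K≡H∘⊕c (x ⊕ c)) (cong H (⊕-involutive x c))

TranslationOn : (Vertex n → Vertex j) → Pattern n → Set
TranslationOn {j = j} f p =
  Σ (free p ≡ j) λ eq → Σ (Vertex j) λ c → ∀ v → f (fill p v) ≡ subst Vertex eq v ⊕ c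

good-pullback : ∀ {d} (H : Config d) {f : Vertex n → Vertex d} {p : Pattern n} →
                TranslationOn f p → Good d H (H ∘ f) p
good-pullback H {f} {p} (refl , c , f≡⊕c) =
  refl , exactCopy-translate H (trace (H ∘ f) p) c (cong H ∘ f≡⊕c)

product : Vec ℕ j → ℕ
product = foldr _ _*_ 1

product-map-* : ∀ c (xs : Vec ℕ j) → product (map (c *_) xs) ≡ c ^ j * product xs
product-map-* c []       = refl
product-map-* {suc j} c (x ∷ xs) = begin
  c * x * product (map (c *_) xs) ≡⟨ cong (c * x *_) (product-map-* c xs) ⟩
  c * x * (c ^ j * product xs)    ≡⟨ regroup c x (c ^ j) (product xs) ⟩
  c * c ^ j * (x * product xs)    ∎
  where
  open ≡-Reasoning
  regroup : ∀ a b e f → a * b * (e * f) ≡ a * e * (b * f)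
  regroup = solve-∀

mP′[1+k]≡m*pred[m]P′k : ∀ m k → m P′ suc k ≡ m * (pred m P′ k)
mP′[1+k]≡m*pred[m]P′k zero    k       = cong (_* (zero P′ k)) (0∸n≡0 k)
mP′[1+k]≡m*pred[m]P′k (suc m) zero    = refl
mP′[1+k]≡m*pred[m]P′k (suc m) (suc k) =
  trans (cong ((m ∸ k) *_) (mP′[1+k]≡m*pred[m]P′k (suc m) k))
        (x∙yz≈y∙xz *-commutativeSemigroup (m ∸ k) (suc m) (m P′ k))

FallingBoundedBy : ℕ → Vec ℕ j → Set
FallingBoundedBy m []       = ⊤
FallingBoundedBy m (b ∷ bs) = m ≤ b × FallingBoundedBy (pred m) bs

P′-≤-product : ∀ m (bs : Vec ℕ j) → FallingBoundedBy m bs → m P′ j ≤ product bs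
P′-≤-product m []       tt = ≤-refl
P′-≤-product {suc j} m (b ∷ bs) (m≤b , bounded) =
  ≤-trans (≤-reflexive (mP′[1+k]≡m*pred[m]P′k m j))
          (*-mono-≤ m≤b (P′-≤-product (pred m) bs bounded))

nPk≡nP′k : ∀ {n k} → k ≤ n → n P k ≡ n P′ k
nPk≡nP′k {n} {k} k≤n with k ≤ᵇ n | ≤⇒≤ᵇ k≤n
... | true | _ = refl

k!*nCk≤nP′k : ∀ {n k} → k ≤ n → k ! * (n C k) ≤ n P′ k
k!*nCk≤nP′k {n} {k} k≤n = begin
  k ! * (n C k)          ≡⟨ cong (k ! *_) (nCk≡nPk/k! k≤n) ⟩
  k ! * ((n P k) / k !)  ≡⟨ *-comm (k !) _ ⟩
  ((n P k) / k !) * k !  ≤⟨ m/n*n≤m (n P k) (k !) ⟩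
  n P k                  ≡⟨ nPk≡nP′k k≤n ⟩
  n P′ k                 ∎
  where
  open ≤-Reasoning
  instance _ = k !≢0

-- An entry k of a block vector stands for a block of suc k consecutive coordinates.
size : Vec ℕ j → ℕ
size ks = sum (map suc ks)

size≡length+sum : (ks : Vec ℕ j) → size ks ≡ j + sum ks
size≡length+sum []       = refl
size≡length+sum {suc j} (k ∷ ks) =
  cong suc (trans (cong (k +_) (size≡length+sum ks)) (x∙yz≈y∙xz +-commutativeSemigroup k j (sum ks)))

parity : (ks : Vec ℕ j) → Vertex (size ks) → Vertex j
parityFrom : (k : ℕ) (ks : Vec ℕ j) → Bool → Vertex (k + size ks) → Vertex (suc j)
parity []       []      = []
parity (k ∷ ks) x       = parityFrom (suc k) ks false x
parityFrom zero    ks acc x       = acc ∷ parity ks x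
parityFrom (suc k) ks acc (b ∷ x) = parityFrom k ks (acc xor b) x

extend : Maybe Bool → List (Pattern n) → List (Pattern (suc n))
extend h = mapˡ (h ∷_)

fixEither : List (Pattern n) → List (Pattern (suc n))
fixEither ps = extend (just false) ps ++ extend (just true) ps

-- The sub-cubes with exactly one varying coordinate in each block.  In the current block
-- that coordinate is either still to be chosen among the next suc k coordinates (open),
-- or already chosen, with the next k coordinates fixed (closed).
transversals : (ks : Vec ℕ j) → List (Pattern (size ks))
open-transversals : (k : ℕ) (ks : Vec ℕ j) → List (Pattern (suc k + size ks))
closed-transversals : (k : ℕ) (ks : Vec ℕ j) → List (Pattern (k + size ks))
transversals []       = [] ∷ˡ []ˡ
transversals (k ∷ ks) = open-transversals k ks
open-transversals zero    ks = extend nothing (transversals ks)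
open-transversals (suc k) ks =
  extend nothing (closed-transversals (suc k) ks) ++ fixEither (open-transversals k ks)
closed-transversals zero    ks = transversals ks
closed-transversals (suc k) ks = fixEither (closed-transversals k ks)

-- Both invariants hold uniformly in the running parity acc; this is what lets them
-- pass through the fixed coordinates of a block.
OpenInvariant : (k : ℕ) (ks : Vec ℕ j) → Pattern (suc k + size ks) → Set
OpenInvariant {j} k ks p = Σ (free p ≡ suc j) λ eq → Σ Bool λ e → Σ (Vertex j) λ c →
  ∀ acc v → parityFrom (suc k) ks acc (fill p v) ≡ subst Vertex eq v ⊕ ((acc xor e) ∷ c)

ClosedInvariant : (k : ℕ) (ks : Vec ℕ j) → Pattern (k + size ks) → Set
ClosedInvariant {j} k ks p = Σ (free p ≡ j) λ eq → Σ Bool λ e → Σ (Vertex j) λ c →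
  ∀ acc v → parityFrom k ks acc (fill p v) ≡ (acc xor e) ∷ (subst Vertex eq v ⊕ c)

subst-∷ : ∀ {m} (eq : m ≡ n) (b : Bool) (v : Vertex m) →
          subst Vertex (cong suc eq) (b ∷ v) ≡ b ∷ subst Vertex eq v
subst-∷ refl b v = refl

closedInvariant-zero : (ks : Vec ℕ j) {p : Pattern (size ks)} →
                       TranslationOn (parity ks) p → ClosedInvariant zero ks p
closedInvariant-zero ks (eq , c , parity≡) =
  eq , false , c , λ acc v → cong₂ _∷_ (sym (xor-identityʳ acc)) (parity≡ v)

closedInvariant-fix : ∀ k (ks : Vec ℕ j) b {p} →
                      ClosedInvariant k ks p → ClosedInvariant (suc k) ks (just b ∷ p)
closedInvariant-fix k ks b (eq , e , c , parity≡) = eq , b xor e , c , λ acc v →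
  trans (parity≡ (acc xor b) v) (cong (_∷ (subst Vertex eq v ⊕ c)) (xor-assoc acc b e))

openInvariant-free : ∀ k (ks : Vec ℕ j) {p} →
                     ClosedInvariant k ks p → OpenInvariant k ks (nothing ∷ p)
openInvariant-free k ks (eq , e , c , parity≡) = cong suc eq , e , c , λ { acc (b ∷ v) →
  trans (parity≡ (acc xor b) v)
    (trans (cong (_∷ (subst Vertex eq v ⊕ c)) (xor-swap acc b e))
           (cong (_⊕ ((acc xor e) ∷ c)) (sym (subst-∷ eq b v)))) }

openInvariant-fix : ∀ k (ks : Vec ℕ j) b {p} →
                    OpenInvariant k ks p → OpenInvariant (suc k) ks (just b ∷ p)
openInvariant-fix k ks b (eq , e , c , parity≡) = eq , b xor e , c , λ acc v →
  trans (parity≡ (acc xor b) v) (cong (λ a → subst Vertex eq v ⊕ (a ∷ c)) (xor-assoc acc b e))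

translationOn-open : ∀ k (ks : Vec ℕ j) {p} →
                     OpenInvariant k ks p → TranslationOn (parity (k ∷ ks)) p
translationOn-open k ks (eq , e , c , parity≡) = eq , e ∷ c , parity≡ false

All-fixEither : ∀ {R : Pattern n → Set} {S : Pattern (suc n) → Set} {ps} →
                (∀ b {p} → R p → S (just b ∷ p)) → All R ps → All S (fixEither ps)
All-fixEither R⇒S all = All.++⁺ (All.gmap⁺ (R⇒S false) all) (All.gmap⁺ (R⇒S true) all)

transversals-translationOn : (ks : Vec ℕ j) → All (TranslationOn (parity ks)) (transversals ks)
open-transversals-invariant : ∀ k (ks : Vec ℕ j) →
                              All (OpenInvariant k ks) (open-transversals k ks)
closed-transversals-invariant : ∀ k (ks : Vec ℕ j) →
                                All (ClosedInvariant k ks) (closed-transversals k ks)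
transversals-translationOn []       = (refl , [] , λ { [] → refl }) All.∷ All.[]
transversals-translationOn (k ∷ ks) =
  All.map (λ {p} → translationOn-open k ks {p}) (open-transversals-invariant k ks)
open-transversals-invariant zero    ks =
  All.gmap⁺ (openInvariant-free zero ks ∘ closedInvariant-zero ks) (transversals-translationOn ks)
open-transversals-invariant (suc k) ks =
  All.++⁺ (All.gmap⁺ (openInvariant-free (suc k) ks) (closed-transversals-invariant (suc k) ks))
          (All-fixEither (openInvariant-fix k ks) (open-transversals-invariant k ks))
closed-transversals-invariant zero    ks =
  All.map (λ {p} → closedInvariant-zero ks {p}) (transversals-translationOn ks)
closed-transversals-invariant (suc k) ks =
  All-fixEither (closedInvariant-fix k ks) (closed-transversals-invariant k ks)

extend-unique : ∀ h {ps : List (Pattern n)} → Unique ps → Unique (extend h ps)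
extend-unique h = Unique.map⁺ ∷-injectiveʳ

∈-extend⇒head : ∀ {h} {ps : List (Pattern n)} {q} → q ∈ extend h ps → head q ≡ h
∈-extend⇒head {h = h} q∈ with ∈-map⁻ (h ∷_) q∈
... | _ , _ , refl = refl

∈-extend⇒head≢ : ∀ {h h′} {ps : List (Pattern n)} {q} → h ≢ h′ → q ∈ extend h ps → head q ≢ h′
∈-extend⇒head≢ h≢h′ q∈ head≡h′ = h≢h′ (trans (sym (∈-extend⇒head q∈)) head≡h′)

∈-fixEither⇒head≢nothing : ∀ {ps : List (Pattern n)} {q} → q ∈ fixEither ps → head q ≢ nothing
∈-fixEither⇒head≢nothing {ps = ps} q∈ with ∈-++⁻ (extend (just false) ps) q∈
... | inj₁ q∈ˡ = ∈-extend⇒head≢ (λ ()) q∈ˡ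
... | inj₂ q∈ʳ = ∈-extend⇒head≢ (λ ()) q∈ʳ

extend-disjoint : ∀ {h} {ps : List (Pattern n)} {qs} →
                  (∀ {q} → q ∈ qs → head q ≢ h) → Disjoint (extend h ps) qs
extend-disjoint head≢ (p∈ , p∈qs) = head≢ p∈qs (∈-extend⇒head p∈)

fixEither-unique : ∀ {ps : List (Pattern n)} → Unique ps → Unique (fixEither ps)
fixEither-unique ps! =
  Unique.++⁺ (extend-unique _ ps!) (extend-unique _ ps!) (extend-disjoint (∈-extend⇒head≢ (λ ())))

transversals-unique : (ks : Vec ℕ j) → Unique (transversals ks)
open-transversals-unique : ∀ k (ks : Vec ℕ j) → Unique (open-transversals k ks)
closed-transversals-unique : ∀ k (ks : Vec ℕ j) → Unique (closed-transversals k ks)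
transversals-unique []       = All.[] AllPairs.∷ AllPairs.[]
transversals-unique (k ∷ ks) = open-transversals-unique k ks
open-transversals-unique zero    ks = extend-unique nothing (transversals-unique ks)
open-transversals-unique (suc k) ks =
  Unique.++⁺ (extend-unique nothing (closed-transversals-unique (suc k) ks))
             (fixEither-unique (open-transversals-unique k ks))
             (extend-disjoint (∈-fixEither⇒head≢nothing {ps = open-transversals k ks}))
closed-transversals-unique zero    ks = transversals-unique ks
closed-transversals-unique (suc k) ks = fixEither-unique (closed-transversals-unique k ks)

length-fixEither : (ps : List (Pattern n)) → length (fixEither ps) ≡ 2 * length ps
length-fixEither ps = begin
  length (extend (just false) ps ++ extend (just true) ps)
    ≡⟨ length-++ (extend (just false) ps) ⟩
  length (extend (just false) ps) + length (extend (just true) ps)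
    ≡⟨ cong₂ _+_ (length-map _ ps) (length-map _ ps) ⟩
  length ps + length ps
    ≡⟨ cong (length ps +_) (+-identityʳ (length ps)) ⟨
  2 * length ps
    ∎
  where open ≡-Reasoning

length-closed-transversals : ∀ k (ks : Vec ℕ j) →
  length (closed-transversals k ks) ≡ 2 ^ k * length (transversals ks)
length-closed-transversals zero    ks = sym (+-identityʳ _)
length-closed-transversals (suc k) ks = begin
  length (fixEither (closed-transversals k ks)) ≡⟨ length-fixEither (closed-transversals k ks) ⟩
  2 * length (closed-transversals k ks)         ≡⟨ cong (2 *_) (length-closed-transversals k ks) ⟩
  2 * (2 ^ k * length (transversals ks))        ≡⟨ *-assoc 2 (2 ^ k) _ ⟨
  2 ^ suc k * length (transversals ks)          ∎
  where open ≡-Reasoning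

length-open-transversals : ∀ k (ks : Vec ℕ j) →
  length (open-transversals k ks) ≡ suc k * 2 ^ k * length (transversals ks)
length-open-transversals zero    ks = trans (length-map _ (transversals ks)) (sym (+-identityʳ _))
length-open-transversals (suc k) ks = begin
  length (extend nothing cs ++ fixEither os)
    ≡⟨ length-++ (extend nothing cs) ⟩
  length (extend nothing cs) + length (fixEither os)
    ≡⟨ cong₂ _+_ (length-map _ cs) (length-fixEither os) ⟩
  length cs + 2 * length os
    ≡⟨ cong₂ _+_ (length-closed-transversals (suc k) ks) (cong (2 *_) (length-open-transversals k ks)) ⟩
  2 * 2 ^ k * L + 2 * (suc k * 2 ^ k * L)
    ≡⟨ regroup k (2 ^ k) L ⟩
  suc (suc k) * 2 ^ suc k * L
    ∎
  where
  open ≡-Reasoning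
  cs = closed-transversals (suc k) ks
  os = open-transversals k ks
  L = length (transversals ks)
  regroup : ∀ k a b → 2 * a * b + 2 * (suc k * a * b) ≡ suc (suc k) * (2 * a) * b
  regroup = solve-∀

length-transversals : (ks : Vec ℕ j) → length (transversals ks) ≡ product (map suc ks) * 2 ^ sum ks
length-transversals []       = refl
length-transversals (k ∷ ks) = begin
  length (open-transversals k ks)          ≡⟨ length-open-transversals k ks ⟩
  suc k * 2 ^ k * length (transversals ks) ≡⟨ cong (suc k * 2 ^ k *_) (length-transversals ks) ⟩
  suc k * 2 ^ k * (∏s * 2 ^ sum ks)        ≡⟨ regroup (suc k) (2 ^ k) ∏s (2 ^ sum ks) ⟩
  suc k * ∏s * (2 ^ k * 2 ^ sum ks)        ≡⟨ cong (suc k * ∏s *_) (^-distribˡ-+-* 2 k (sum ks)) ⟨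
  suc k * ∏s * 2 ^ (k + sum ks)            ∎
  where
  open ≡-Reasoning
  ∏s = product (map suc ks)
  regroup : ∀ a b c e → a * b * (c * e) ≡ a * c * (b * e)
  regroup = solve-∀

exAtLeast-blocks : ∀ {d a b} (H : Config d) (ks : Vec ℕ d) →
                   a * (size ks C d) ≤ b * product (map suc ks) → exAtLeast d H (size ks) a b
exAtLeast-blocks {d} {a} {b} H ks bound =
  H ∘ parity ks , transversals ks , transversals-unique ks ,
  All.map (λ {p} → good-pullback H {parity ks} {p}) (transversals-translationOn ks) , count
  where
  open ≤-Reasoning
  binom = size ks C d
  ∏s = product (map suc ks)
  size∸d≡sum : size ks ∸ d ≡ sum ks
  size∸d≡sum = trans (cong (_∸ d) (size≡length+sum ks)) (m+n∸m≡n d (sum ks))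
  count : a * (binom * 2 ^ (size ks ∸ d)) ≤ b * length (transversals ks)
  count = begin
    a * (binom * 2 ^ (size ks ∸ d)) ≡⟨ cong (λ e → a * (binom * 2 ^ e)) size∸d≡sum ⟩
    a * (binom * 2 ^ sum ks)        ≡⟨ *-assoc a binom _ ⟨
    a * binom * 2 ^ sum ks          ≤⟨ *-monoˡ-≤ (2 ^ sum ks) bound ⟩
    b * ∏s * 2 ^ sum ks             ≡⟨ *-assoc b ∏s _ ⟩
    b * (∏s * 2 ^ sum ks)           ≡⟨ cong (b *_) (length-transversals ks) ⟨
    b * length (transversals ks)    ∎

exAtLeast-fallingBounded : ∀ {d} (H : Config d) (ks : Vec ℕ d) →
                           FallingBoundedBy (size ks) (map (d *_) (map suc ks)) →
                           exAtLeast d H (size ks) (d !) (d ^ d)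
exAtLeast-fallingBounded {d} H ks bounded = exAtLeast-blocks {a = d !} {d ^ d} H ks (begin
  d ! * (size ks C d)               ≤⟨ k!*nCk≤nP′k d≤size ⟩
  size ks P′ d                      ≤⟨ P′-≤-product (size ks) _ bounded ⟩
  product (map (d *_) (map suc ks)) ≡⟨ product-map-* d (map suc ks) ⟩
  d ^ d * product (map suc ks)      ∎)
  where
  open ≤-Reasoning
  d≤size : d ≤ size ks
  d≤size = subst (d ≤_) (sym (size≡length+sum ks)) (m≤m+n d (sum ks))

balanced : (k j r : ℕ) → Vec ℕ j
balanced k zero    r       = []
balanced k (suc j) zero    = k ∷ balanced k j zero
balanced k (suc j) (suc r) = suc k ∷ balanced k j r

size-balanced : ∀ k j {r} → r ≤ j → size (balanced k j r) ≡ j * suc k + r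
size-balanced k zero    z≤n       = refl
size-balanced k (suc j) z≤n       =
  trans (cong (suc k +_) (size-balanced k j z≤n)) (sym (+-assoc (suc k) (j * suc k) 0))
size-balanced k (suc j) (s≤s r≤j) =
  trans (cong (suc (suc k) +_) (size-balanced k j r≤j)) (regroup (suc k) (j * suc k) _)
  where
  regroup : ∀ a b c → suc a + (b + c) ≡ a + b + suc c
  regroup = solve-∀

balanced-fallingBounded : ∀ {d} k j {r m} → r ≤ d → m ≤ d * suc k + r →
                          FallingBoundedBy m (map (d *_) (map suc (balanced k j r)))
balanced-fallingBounded k zero r≤d m≤ = tt
balanced-fallingBounded {d} k (suc j) {zero} {m} r≤d m≤ =
  subst (m ≤_) (+-identityʳ (d * suc k)) m≤ ,
  balanced-fallingBounded k j r≤d (≤-trans pred[n]≤n m≤)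
balanced-fallingBounded {d} k (suc j) {suc r} {m} r<d m≤ =
  ≤-trans m≤ (≤-trans (+-monoʳ-≤ (d * suc k) r<d) (≤-reflexive d*[1+k]+d≡d*[2+k])) ,
  balanced-fallingBounded k j (≤-trans (n≤1+n r) r<d)
    (subst (pred m ≤_) (cong pred (+-suc (d * suc k) r)) (pred-mono-≤ m≤))
  where
  d*[1+k]+d≡d*[2+k] : d * suc k + d ≡ d * suc (suc k)
  d*[1+k]+d≡d*[2+k] = trans (+-comm (d * suc k) d) (sym (*-suc d (suc k)))

balanced-partition : ∀ {d n} → 1 ≤ d → d ≤ n →
  Σ (Vec ℕ d) λ ks → size ks ≡ n × FallingBoundedBy n (map (d *_) (map suc ks))
balanced-partition {d@(suc _)} {n} _ d≤n with n / d in q≡ | m≥n⇒m/n>0 {n} {d} d≤n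
... | suc k | _ = balanced k d (n % d) , trans (size-balanced k d r≤d) (sym n≡) ,
                  balanced-fallingBounded k d r≤d (≤-reflexive n≡)
  where
  r≤d : n % d ≤ d
  r≤d = <⇒≤ (m%n<n n d)
  n≡ : n ≡ d * suc k + n % d
  n≡ = begin
    n                 ≡⟨ m≡m%n+[m/n]*n n d ⟩
    n % d + n / d * d ≡⟨ +-comm (n % d) _ ⟩
    n / d * d + n % d ≡⟨ cong (λ q → q * d + n % d) q≡ ⟩
    suc k * d + n % d ≡⟨ cong (_+ n % d) (*-comm (suc k) d) ⟩
    d * suc k + n % d ∎
    where open ≡-Reasoning

proposition5 : (d : ℕ) → 1 ≤ d → (H : Config d) →
    (n : ℕ) → d ≤ n → exAtLeast d H n (d !) (d ^ d)
proposition5 d 1≤d H n d≤n with balanced-partition 1≤d d≤n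
... | ks , refl , bounded = exAtLeast-fallingBounded H ks bounded
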